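{- Let $G$ be a finite, simple, undirected, connected graph. If ${\rm dmg}(G)=1$, then ${\rm rad}(G)=2$.
   Context: ${\rm rad}$ denotes the radius. Damage game on a graph: one cop and one robber; in round $0$ the cop chooses a vertex, then the robber does; in each later round the cop moves to an adjacent vertex or passes, then the robber moves to an adjacent vertex or passes; the robber is captured if the cop occupies the robber's vertex. A vertex $v$ is damaged if the robber occupies $v$ in some round $i\ge0$ and in round $i+1$ the uncaptured robber passes or moves to a neighbour. The damage number ${\rm dmg}(\cdot)$ is the number of distinct vertices damaged when the cop plays to minimize and the robber to maximize this number. -}

module Defs where

open import Level using (0ℓ)
open import Data.Nat using (ℕ; zero; suc; _≤_)
open import Data.Fin using (Fin)
open import Data.List using (List; []; _∷_; length)
open import Data.List.Membership.Propositional using (_∈_)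
open import Data.List.Relation.Unary.All using (All)
open import Data.List.Relation.Unary.Unique.Propositional using (Unique)
open import Data.Product using (Σ; ∃; ∃-syntax; _×_; _,_; proj₁; proj₂)
open import Data.Sum using (_⊎_)
open import Relation.Nullary using (¬_; Dec)
open import Relation.Binary.PropositionalEquality using (_≡_; _≢_)

record Graph : Set₁ where
  field
    n      : ℕ
    Adj    : Fin n → Fin n → Set
    adj?   : ∀ u v → Dec (Adj u v)
    sym    : ∀ {u v} → Adj u v → Adj v u
    irrefl : ∀ {u} → ¬ Adj u u

module _ (G : Graph) where
  open Graph G

  V : Set
  V = Fin n

  data Walk : V → V → ℕ → Set where
    here : ∀ {u} → Walk u u 0
    step : ∀ {u w v k} → Adj u w → Walk w v k → Walk u v (suc k)

  Connected : Set
  Connected = ∀ u v → ∃[ k ] Walk u v k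

  Dist : V → V → ℕ → Set
  Dist u v d = Walk u v d × (∀ k → Walk u v k → d ≤ k)

  Ecc : V → ℕ → Set
  Ecc v e = (∀ u → ∃[ d ] (Dist v u d × d ≤ e)) × (∃[ u ] Dist v u e)

  Radius : ℕ → Set
  Radius r = (∃[ v ] Ecc v r) × (∀ v e → Ecc v e → r ≤ e)

  -- The damage game (one cop, one robber, full information).
  -- A history is the list of earlier position pairs (cop, robber),
  -- most recent first.

  Move : V → V → Set
  Move x y = Adj x y ⊎ y ≡ x

  record CopStrategy : Set where
    field
      start : V
      move  : (c r : V) → List (V × V) → V
      legal : ∀ c r h → Move c (move c r h)

  record RobberStrategy : Set where
    field
      start : V → V                               -- round 0, knowing cop's start
      move  : (c r : V) → List (V × V) → (c' : V) → V  -- also knows cop's new position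
      legal : ∀ c r h c' → Move r (move c r h c')

  module Play (σ : CopStrategy) (τ : RobberStrategy) where
    private
      module σ = CopStrategy σ
      module τ = RobberStrategy τ

    state : ℕ → V × V × List (V × V)
    state zero = σ.start , τ.start σ.start , []
    state (suc i) with state i
    ... | c , r , h =
      let c' = σ.move c r h in c' , τ.move c r h c' , (c , r) ∷ h

    cop : ℕ → V
    cop i = proj₁ (state i)

    rob : ℕ → V
    rob i = proj₁ (proj₂ (state i))

    -- v is damaged: robber is on v in round i (not yet captured) and in
    -- round i+1 the cop does not capture it (so it passes or moves on)
    Damaged : V → Set
    Damaged v = ∃[ i ] (rob i ≡ v × (∀ j → j ≤ i → cop j ≢ rob j)
                        × cop (suc i) ≢ rob i)

    DamageAtMost : ℕ → Set
    DamageAtMost k = ∃[ L ] (length L ≤ k × (∀ v → Damaged v → v ∈ L))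

    DamageAtLeast : ℕ → Set
    DamageAtLeast k = ∃[ L ] (length L ≡ k × Unique L × All Damaged L)

  Dmg : ℕ → Set
  Dmg k = (Σ CopStrategy λ σ → ∀ τ → Play.DamageAtMost σ τ k)
        × (∀ σ → Σ RobberStrategy λ τ → Play.DamageAtLeast σ τ k)

-- If the cop starts on a dominating vertex and always steps onto the robber, the
-- robber is caught before it can damage anything, so dmg(G) = 1 rules out
-- eccentricity at most 1. Conversely, let the cop start at c under a strategy
-- holding the damage to 1. A vertex u more than two moves away from c, with a
-- neighbour b, is fatal: the robber starts at b and steps to u, and the cop
-- reaches neither in time, so b and u are both damaged. Hence c has
-- eccentricity 2.
module Submission where

open import Defs
open import Data.Nat using (zero; suc; _≤_; z≤n; s≤s; _≤?_)
open import Data.Nat.Properties using (≤-trans; ≰⇒>)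
open import Data.Fin using (_≟_)
open import Data.Fin.Properties using (any?; ¬∀⟶∃¬)
open import Data.List using ([]; _∷_)
open import Data.List.Relation.Unary.All using (_∷_)
open import Data.List.Relation.Unary.Any using (here)
open import Data.Product using (∃-syntax; _×_; _,_; proj₂)
open import Data.Sum using (inj₁; inj₂)
open import Data.Empty using (⊥-elim)
open import Relation.Nullary using (¬_; Dec; yes; no)
open import Relation.Nullary.Decidable using (_×-dec_; _⊎-dec_; decidable-stable)
open import Relation.Binary.PropositionalEquality using (_≡_; _≢_; refl; sym; trans; subst)

module _ (G : Graph) where
  open Graph G renaming (sym to adj-sym)

  Dominating : V G → Set
  Dominating c = ∀ u → Move G c u

  Reach₂ : V G → V G → Set
  Reach₂ c u = ∃[ x ] (Move G c x × Move G x u)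

  move? : ∀ x y → Dec (Move G x y)
  move? x y = adj? x y ⊎-dec (y ≟ x)

  reach₂? : ∀ c u → Dec (Reach₂ c u)
  reach₂? c u = any? λ x → move? c x ×-dec move? x u

  ¬dominating⇒undominated : ∀ {c} → ¬ Dominating c → ∃[ u ] ¬ Move G c u
  ¬dominating⇒undominated {c} = ¬∀⟶∃¬ _ (Move G c) (move? c)

  walk≤1⇒move : ∀ {c u d} → Walk G c u d → d ≤ 1 → Move G c u
  walk≤1⇒move here                _        = inj₂ refl
  walk≤1⇒move (step a here)       _        = inj₁ a
  walk≤1⇒move (step _ (step _ _)) (s≤s ())

  ¬move⇒walk≥2 : ∀ {c u k} → ¬ Move G c u → Walk G c u k → 2 ≤ k
  ¬move⇒walk≥2 {k = k} ¬m w with k ≤? 1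
  ... | yes k≤1 = ⊥-elim (¬m (walk≤1⇒move w k≤1))
  ... | no  k≰1 = ≰⇒> k≰1

  adj⇒dist₁ : ∀ {c u} → Adj c u → Dist G c u 1
  adj⇒dist₁ a = step a here , λ { zero here → ⊥-elim (irrefl a) ; (suc _) _ → s≤s z≤n }

  dist₂ : ∀ {c x u} → ¬ Move G c u → Adj c x → Adj x u → Dist G c u 2
  dist₂ ¬m a a′ = step a (step a′ here) , λ _ → ¬move⇒walk≥2 ¬m

  reach₂⇒dist₂ : ∀ {c u} → ¬ Move G c u → Reach₂ c u → Dist G c u 2
  reach₂⇒dist₂ ¬m (_ , inj₂ refl , m′)      = ⊥-elim (¬m m′)
  reach₂⇒dist₂ ¬m (_ , inj₁ a    , inj₂ refl) = ⊥-elim (¬m (inj₁ a))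
  reach₂⇒dist₂ ¬m (_ , inj₁ a    , inj₁ a′)   = dist₂ ¬m a a′

  reach₂⇒dist≤2 : ∀ {c u} → Reach₂ c u → ∃[ d ] (Dist G c u d × d ≤ 2)
  reach₂⇒dist≤2 {c} {u} r with move? c u
  ... | yes (inj₂ refl) = 0 , (here , λ _ _ → z≤n) , z≤n
  ... | yes (inj₁ a)    = 1 , adj⇒dist₁ a , s≤s z≤n
  ... | no ¬m           = 2 , reach₂⇒dist₂ ¬m r , s≤s (s≤s z≤n)

  ecc≤1⇒dominating : ∀ {v e} → Ecc G v e → e ≤ 1 → Dominating v
  ecc≤1⇒dominating (ball , _) e≤1 u with ball u
  ... | _ , (w , _) , d≤e = walk≤1⇒move w (≤-trans d≤e e≤1)

  reach₂⇒ecc₂ : ∀ {c} → (∀ u → Reach₂ c u) → ∃[ u ] ¬ Move G c u → Ecc G c 2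
  reach₂⇒ecc₂ reach (u , ¬m) =
    (λ v → reach₂⇒dist≤2 (reach v)) , u , reach₂⇒dist₂ ¬m (reach u)

  module _ (σ : CopStrategy G) (τ : RobberStrategy G) where
    open Play G σ τ
    private
      module σ = CopStrategy σ
      module τ = RobberStrategy τ

    cop-moves : ∀ i → Move G (cop i) (cop (suc i))
    cop-moves i = σ.legal (cop i) (rob i) (proj₂ (proj₂ (state i)))

    rob-moves : ∀ i → Move G (rob i) (rob (suc i))
    rob-moves i = τ.legal (cop i) (rob i) (proj₂ (proj₂ (state i))) (cop (suc i))

    damaged-unique : DamageAtMost 1 → ∀ {x y} → Damaged x → Damaged y → x ≡ y
    damaged-unique ([] , _ , covers) dx _ with covers _ dx
    ... | ()
    damaged-unique (_ ∷ [] , _ , covers) dx dy with covers _ dx | covers _ dy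
    ... | here refl | here refl = refl
    damaged-unique (_ ∷ _ ∷ _ , s≤s () , _)

    undamaged⇒¬damageAtLeast : (∀ v → ¬ Damaged v) → ∀ k → ¬ DamageAtLeast (suc k)
    undamaged⇒¬damageAtLeast undamaged _ (v ∷ _ , _ , _ , dv ∷ _) = undamaged v dv

  chaseMove : (c r : V G) → Dec (Adj c r) → V G
  chaseMove c r (yes _) = r
  chaseMove c r (no _)  = c

  chaseMove-legal : ∀ c r d → Move G c (chaseMove c r d)
  chaseMove-legal c r (yes a) = inj₁ a
  chaseMove-legal c r (no _)  = inj₂ refl

  chaseMove-captures : ∀ {c r} d → Move G c r → chaseMove c r d ≡ r
  chaseMove-captures (yes _) _           = refl
  chaseMove-captures (no _)  (inj₂ refl) = refl
  chaseMove-captures (no ¬a) (inj₁ a)    = ⊥-elim (¬a a)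

  chase : V G → CopStrategy G
  chase c = record
    { start = c
    ; move  = λ c r _ → chaseMove c r (adj? c r)
    ; legal = λ c r _ → chaseMove-legal c r (adj? c r)
    }

  module _ {c : V G} (dominating : Dominating c) (τ : RobberStrategy G) where
    open Play G (chase c) τ

    chase-adjacent : ∀ i → Move G (cop i) (rob i)
    chase-captures : ∀ i → cop (suc i) ≡ rob i

    chase-adjacent zero    = dominating (rob zero)
    chase-adjacent (suc i) =
      subst (λ x → Move G x (rob (suc i))) (sym (chase-captures i)) (rob-moves (chase c) τ i)
    chase-captures i = chaseMove-captures (adj? (cop i) (rob i)) (chase-adjacent i)

    chase-undamaged : ∀ v → ¬ Damaged v
    chase-undamaged _ (i , _ , _ , escapes) = escapes (chase-captures i)

  dmg₁⇒¬dominating : Dmg G 1 → ∀ c → ¬ Dominating c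
  dmg₁⇒¬dominating (_ , robberWins) c dominating with robberWins (chase c)
  ... | τ , atLeast1 =
    undamaged⇒¬damageAtLeast (chase c) τ (chase-undamaged dominating τ) 0 atLeast1

  runMove : (u r : V G) → Dec (Adj r u) → V G
  runMove u r (yes _) = u
  runMove u r (no _)  = r

  runMove-legal : ∀ u r d → Move G r (runMove u r d)
  runMove-legal u r (yes a) = inj₁ a
  runMove-legal u r (no _)  = inj₂ refl

  runMove-arrives : ∀ {u r} → Adj r u → (d : Dec (Adj r u)) → runMove u r d ≡ u
  runMove-arrives _ (yes _) = refl
  runMove-arrives a (no ¬a) = ⊥-elim (¬a a)

  runTo : (b u : V G) → RobberStrategy G
  runTo b u = record
    { start = λ _ → b
    ; move  = λ _ r _ _ → runMove u r (adj? r u)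
    ; legal = λ _ r _ _ → runMove-legal u r (adj? r u)
    }

  module _ (σ : CopStrategy G) {b u : V G}
           (far : ¬ Reach₂ (CopStrategy.start σ) u) (b~u : Adj b u) where
    open Play G σ (runTo b u)

    cop-legal : ∀ i → Move G (cop i) (cop (suc i))
    cop-legal = cop-moves σ (runTo b u)

    cop-move≢b : ∀ {x} → Move G (cop 0) x → x ≢ b
    cop-move≢b m x≡b = far (_ , m , subst (λ y → Move G y u) (sym x≡b) (inj₁ b~u))

    rob₁≡u : rob 1 ≡ u
    rob₁≡u = runMove-arrives b~u (adj? b u)

    runTo-damages-start : Damaged b
    runTo-damages-start =
      0 , refl , (λ { zero z≤n → cop-move≢b (inj₂ refl) }) , cop-move≢b (cop-legal 0)

    runTo-damages-target : Damaged u
    runTo-damages-target = 1 , rob₁≡u , uncaught , cop₂≢u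
      where
        cop₁≢u : cop 1 ≢ rob 1
        cop₁≢u e = far (cop 1 , cop-legal 0 , inj₂ (trans (sym rob₁≡u) (sym e)))
        cop₂≢u : cop 2 ≢ rob 1
        cop₂≢u e =
          far (cop 1 , cop-legal 0 , subst (Move G (cop 1)) (trans e rob₁≡u) (cop-legal 1))
        uncaught : ∀ j → j ≤ 1 → cop j ≢ rob j
        uncaught zero       _         = cop-move≢b (inj₂ refl)
        uncaught (suc zero) (s≤s z≤n) = cop₁≢u

  damage≤1⇒reach₂ : (σ : CopStrategy G) → (∀ τ → Play.DamageAtMost G σ τ 1) →
                    Connected G → ∀ u → Reach₂ (CopStrategy.start σ) u
  damage≤1⇒reach₂ σ atMost1 connected u =
    decidable-stable (reach₂? _ u) (escape (connected u _))
    where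
      escape : ∃[ k ] Walk G u (CopStrategy.start σ) k → ¬ ¬ Reach₂ (CopStrategy.start σ) u
      escape (_ , here) far = far (u , inj₂ refl , inj₂ refl)
      escape (_ , step {w = b} u~b _) far
        with damaged-unique σ (runTo b u) (atMost1 (runTo b u))
               (runTo-damages-start σ far (adj-sym u~b))
               (runTo-damages-target σ far (adj-sym u~b))
      ... | refl = irrefl u~b

lemma25 : (G : Graph) → Connected G → Dmg G 1 → Radius G 2
lemma25 G connected dmg₁@((σ , atMost1) , _) =
    ( c
    , reach₂⇒ecc₂ G (damage≤1⇒reach₂ G σ atMost1 connected)
                    (¬dominating⇒undominated G (¬dominating c)))
  , λ v e ecc → ≰⇒> (λ e≤1 → ¬dominating v (ecc≤1⇒dominating G ecc e≤1))
  where
    c : V G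
    c = CopStrategy.start σ
    ¬dominating : ∀ v → ¬ Dominating G v
    ¬dominating = dmg₁⇒¬dominating G dmg₁
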